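{- Let $G$ be a finite graph which is not prime, with $|V(G)|\geq 4$ and $\alpha_M(G)=\omega_M(G)=1$. Then $p(G)=1$.
   Context: Graphs are finite, simple and undirected. For $W\subseteq V(G)$, $G[W]$ is the induced subgraph. A subset $M\subseteq V(G)$ is a module of $G$ if every $v\in V(G)\setminus M$ is adjacent either to all vertices of $M$ or to none of them; the modules $\emptyset$, $V(G)$ and the singletons are trivial. A graph $G$ is prime if $|V(G)|\geq 4$ and all its modules are trivial. An extension of $G$ is a graph $H$ with $V(H)\supseteq V(G)$ and $H[V(G)]=G$; a $p$-extension is an extension with $|V(H)\setminus V(G)|=p$. The prime bound $p(G)$ is the smallest integer $p\ge 0$ such that $G$ admits a prime $p$-extension. The modular clique number $\omega_M(G)$ is the largest size of a module of $G$ that is a clique in $G$; the modular stability number $\alpha_M(G)$ is the largest size of a module of $G$ that is a stable set in $G$. -}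

module Defs where

open import Data.Nat using (ℕ; _+_; _≤_; _<_)
open import Data.Fin using (Fin; _↑ˡ_)
open import Data.Fin.Subset using (Subset; _∈_; _∉_; ∣_∣; ⊥; ⊤)
open import Data.Bool using (Bool; true; false)
open import Data.Product using (Σ; _×_; ∃)
open import Data.Sum using (_⊎_)
open import Relation.Binary.PropositionalEquality using (_≡_; _≢_)
open import Relation.Nullary using (¬_)

record Graph (n : ℕ) : Set where
  field
    adj   : Fin n → Fin n → Bool
    sym   : ∀ x y → adj x y ≡ adj y x
    irrefl : ∀ x → adj x x ≡ false
open Graph public

IsModule : ∀ {n} → Graph n → Subset n → Set
IsModule {n} G M = ∀ (v : Fin n) → v ∉ M →
  ((∀ x → x ∈ M → adj G v x ≡ true) ⊎ (∀ x → x ∈ M → adj G v x ≡ false))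

IsTrivial : ∀ {n} → Subset n → Set
IsTrivial M = (M ≡ ⊥) ⊎ ((M ≡ ⊤) ⊎ (∣ M ∣ ≡ 1))

IsPrime : ∀ {n} → Graph n → Set
IsPrime {n} G = (4 ≤ n) × (∀ M → IsModule G M → IsTrivial M)

IsStable : ∀ {n} → Graph n → Subset n → Set
IsStable G M = ∀ x y → x ∈ M → y ∈ M → adj G x y ≡ false

IsClique : ∀ {n} → Graph n → Subset n → Set
IsClique G M = ∀ x y → x ∈ M → y ∈ M → x ≢ y → adj G x y ≡ true

ModularStabilityNumber : ∀ {n} → Graph n → ℕ → Set
ModularStabilityNumber G k =
  (Σ _ λ M → IsModule G M × IsStable G M × (∣ M ∣ ≡ k)) ×
  (∀ M → IsModule G M → IsStable G M → ∣ M ∣ ≤ k)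

ModularCliqueNumber : ∀ {n} → Graph n → ℕ → Set
ModularCliqueNumber G k =
  (Σ _ λ M → IsModule G M × IsClique G M × (∣ M ∣ ≡ k)) ×
  (∀ M → IsModule G M → IsClique G M → ∣ M ∣ ≤ k)

IsExtension : ∀ {n} (p : ℕ) → Graph n → Graph (n + p) → Set
IsExtension {n} p G H = ∀ (i j : Fin n) → adj H (i ↑ˡ p) (j ↑ˡ p) ≡ adj G i j

HasPrimeExtension : ∀ {n} → Graph n → ℕ → Set
HasPrimeExtension {n} G p = Σ (Graph (n + p)) λ H → IsExtension p G H × IsPrime H

PrimeBound : ∀ {n} → Graph n → ℕ → Set
PrimeBound G p = HasPrimeExtension G p × (∀ q → q < p → ¬ HasPrimeExtension G q)

module Submission where

-- αM = ωM = 1 says that G has no twins: twins p, q would form a module {p, q} of size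
-- two that is a clique or a stable set. As G itself is not prime, the theorem follows from
--
--   (★) a twin-free vertex set W with two vertices has a one-vertex extension W + v that
--       is prime, where N(v) ∩ W = X contains two vertices of W and misses two.
--
-- (★) is proved by strong induction on |W|, for vertex sets W of one fixed graph:
--   * W prime: a counting argument picks N(v) = {a, b} (or its complement) such that v
--     has no twin, and a vertex without twin keeps a prime graph prime;
--   * otherwise W has a maximal proper module M. Induction gives Y for M; the new vertex
--     follows Y on M, and off M it follows the extension X' of the quotient W' obtained by
--     contracting M to one vertex m (induction again) — unless W' has twins, which forces
--     W = M ∪ {u}, and then v is joined to u iff u is not joined to M.

open import Defs hiding (sym)
open import Data.Nat using (ℕ; zero; suc; _+_; _≤_; _<_; z≤n; s≤s)
open import Data.Nat.Properties
open import Data.Bool using (Bool; true; false; not; _∧_; _∨_; if_then_else_)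
open import Data.Bool.Properties using (∧-identityʳ; ∧-zeroʳ; ∨-zeroʳ; not-involutive; not-¬)
  renaming (_≟_ to _≟ᴮ_)
open import Data.Maybe using (Maybe; just; nothing)
open import Data.Maybe.Properties using (just-injective)
open import Data.Fin using (Fin; zero; suc; _↑ˡ_; _↑ʳ_; splitAt) renaming (_≟_ to _≟ᶠ_)
open import Data.Fin.Properties
  using (all?; any?; ¬∀⟶∃¬; splitAt-↑ˡ; splitAt-↑ʳ; join-splitAt)
  renaming (suc-injective to sucᶠ-injective)
open import Data.Fin.Subset as Subset using (Subset)
open import Data.Fin.Subset.Properties using (anySubset?)
open import Data.Vec using ([]; _∷_; lookup; tabulate; replicate)
open import Data.Vec.Properties using (lookup∘tabulate; []=⇒lookup; lookup⇒[]=; lookup-replicate)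
open import Data.Product using (Σ; _×_; _,_; proj₁; proj₂; ∃)
open import Data.Sum using (_⊎_; inj₁; inj₂; [_,_]′)
open import Data.Empty using (⊥; ⊥-elim)
open import Relation.Nullary using (¬_; Dec; yes; no; does; contradiction)
open import Relation.Nullary.Decidable using (dec-true; dec-false; map′; _×-dec_; _→-dec_; ¬?)
open import Relation.Binary.PropositionalEquality

_==_ : ∀ {n} → Fin n → Fin n → Bool
x == y = does (x ≟ᶠ y)

==-refl : ∀ {n} (x : Fin n) → (x == x) ≡ true
==-refl x = dec-true (x ≟ᶠ x) refl

==-≢ : ∀ {n} {x y : Fin n} → x ≢ y → (x == y) ≡ false
==-≢ {x = x} {y} = dec-false (x ≟ᶠ y)

==⇒≡ : ∀ {n} {x y : Fin n} → (x == y) ≡ true → x ≡ y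
==⇒≡ {x = x} {y} h with x ≟ᶠ y
... | yes x≡y = x≡y
... | no _ = contradiction h λ ()

true≢false : true ≢ false
true≢false ()

≢true⇒false : ∀ {b} → b ≢ true → b ≡ false
≢true⇒false {true} h = contradiction refl h
≢true⇒false {false} h = refl

≢false⇒true : ∀ {b} → b ≢ false → b ≡ true
≢false⇒true {true} h = refl
≢false⇒true {false} h = contradiction refl h

bool-pigeonhole : ∀ (x y z : Bool) → y ≡ z ⊎ (x ≡ z ⊎ x ≡ y)
bool-pigeonhole false false _ = inj₂ (inj₂ refl)
bool-pigeonhole true true _ = inj₂ (inj₂ refl)
bool-pigeonhole false true false = inj₂ (inj₁ refl)
bool-pigeonhole false true true = inj₁ refl
bool-pigeonhole true false false = inj₁ refl
bool-pigeonhole true false true = inj₂ (inj₁ refl)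

decT : (b : Bool) → Dec (b ≡ true)
decT b = b ≟ᴮ true

decF : (b : Bool) → Dec (b ≡ false)
decF b = b ≟ᴮ false

b2n : Bool → ℕ
b2n true = 1
b2n false = 0

count : ∀ {n} → (Fin n → Bool) → ℕ
count {zero} f = 0
count {suc n} f = b2n (f zero) + count (λ i → f (suc i))

count-cong : ∀ {n} (f g : Fin n → Bool) → (∀ x → f x ≡ g x) → count f ≡ count g
count-cong {zero} f g e = refl
count-cong {suc n} f g e = cong₂ _+_ (cong b2n (e zero)) (count-cong _ _ (λ i → e (suc i)))

count-empty : ∀ {n} (f : Fin n → Bool) → (∀ x → f x ≡ false) → count f ≡ 0
count-empty {zero} f e = refl
count-empty {suc n} f e rewrite e zero = count-empty _ (λ i → e (suc i))

count-bound : ∀ {n} (f : Fin n → Bool) → count f ≤ n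
count-bound {zero} f = z≤n
count-bound {suc n} f with f zero
... | true = s≤s (count-bound _)
... | false = m≤n⇒m≤1+n (count-bound _)

count-mono : ∀ {n} (f g : Fin n → Bool) → (∀ x → f x ≡ true → g x ≡ true) → count f ≤ count g
count-mono {zero} f g h = z≤n
count-mono {suc n} f g h =
  +-mono-≤ (b2n-mono (f zero) (g zero) (h zero)) (count-mono _ _ (λ i → h (suc i)))
  where
  b2n-mono : ∀ a b → (a ≡ true → b ≡ true) → b2n a ≤ b2n b
  b2n-mono true b a⇒b rewrite a⇒b refl = ≤-refl
  b2n-mono false b a⇒b = z≤n

count-remove : ∀ {n} (f : Fin n → Bool) (p : Fin n) → f p ≡ true →
  count f ≡ suc (count (λ j → f j ∧ not (j == p)))
count-remove {suc n} f zero fp rewrite fp =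
  cong suc (count-cong _ _ (λ i → sym (∧-identityʳ (f (suc i)))))
count-remove {suc n} f (suc p) fp with f zero
... | true = cong suc (count-remove (λ i → f (suc i)) p fp)
... | false = count-remove (λ i → f (suc i)) p fp

count-two : ∀ {n} (f : Fin n → Bool) (p q : Fin n) → f p ≡ true → f q ≡ true → p ≢ q → 2 ≤ count f
count-two f p q fp fq p≢q = begin
  2                                          ≤⟨ s≤s (s≤s z≤n) ⟩
  suc (suc (count (λ j → f∖p j ∧ not (j == q)))) ≡⟨ cong suc (count-remove f∖p q f∖p-q) ⟨
  suc (count f∖p)                            ≡⟨ count-remove f p fp ⟨
  count f                                    ∎
  where
  open ≤-Reasoning
  f∖p : _ → Bool
  f∖p j = f j ∧ not (j == p)
  f∖p-q : f∖p q ≡ true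
  f∖p-q rewrite fq | ==-≢ (≢-sym p≢q) = refl

count-strict : ∀ {n} (f g : Fin n → Bool) → (∀ x → f x ≡ true → g x ≡ true) →
  (z : Fin n) → g z ≡ true → f z ≡ false → count f < count g
count-strict f g f⊆g z gz fz rewrite count-remove g z gz = s≤s (count-mono f _ f⊆g∖z)
  where
  f⊆g∖z : ∀ x → f x ≡ true → g x ∧ not (x == z) ≡ true
  f⊆g∖z x fx with x ≟ᶠ z
  ... | yes refl = contradiction (trans (sym fx) fz) true≢false
  ... | no _ rewrite f⊆g x fx = refl

count-split : ∀ {n} (f p : Fin n → Bool) →
  count f ≡ count (λ x → f x ∧ p x) + count (λ x → f x ∧ not (p x))
count-split {zero} f p = refl
count-split {suc n} f p with f zero | p zero | count-split (λ i → f (suc i)) (λ i → p (suc i))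
... | true | true | ih = cong suc ih
... | true | false | ih = trans (cong suc ih) (sym (+-suc _ _))
... | false | true | ih = ih
... | false | false | ih = ih

injective-suc : ∀ {n m} (S : Fin (suc n) → Bool) (f : Fin (suc n) → Fin m) →
  (∀ x y → S x ≡ true → S y ≡ true → f x ≡ f y → x ≡ y) →
  ∀ x y → S (suc x) ≡ true → S (suc y) ≡ true → f (suc x) ≡ f (suc y) → x ≡ y
injective-suc S f inj x y Sx Sy e = sucᶠ-injective (inj (suc x) (suc y) Sx Sy e)

count-injection : ∀ {n m} (S : Fin n → Bool) (T : Fin m → Bool) (f : Fin n → Fin m) →
  (∀ x → S x ≡ true → T (f x) ≡ true) →
  (∀ x y → S x ≡ true → S y ≡ true → f x ≡ f y → x ≡ y) → count S ≤ count T
count-injection {zero} S T f maps inj = z≤n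
count-injection {suc n} S T f maps inj with S zero in S0
... | false = count-injection (λ i → S (suc i)) T (λ i → f (suc i)) (λ x → maps (suc x))
                (injective-suc S f inj)
... | true rewrite count-remove T (f zero) (maps zero S0) =
  s≤s (count-injection (λ i → S (suc i)) _ (λ i → f (suc i)) maps₊ (injective-suc S f inj))
  where
  maps₊ : ∀ x → S (suc x) ≡ true → T (f (suc x)) ∧ not (f (suc x) == f zero) ≡ true
  maps₊ x Sx with f (suc x) ≟ᶠ f zero
  ... | yes e with () ← inj (suc x) zero Sx S0 e
  ... | no _ rewrite maps (suc x) Sx = refl

-- Module theory inside a vertex set U of a graph E on an arbitrary vertex type.
-- Sets are Boolean predicates; K is only relevant through its trace on U.

Small : ∀ {V : Set} → (V → Bool) → (V → Bool) → Set
Small U K = ∀ a b → U a ≡ true → K a ≡ true → U b ≡ true → K b ≡ true → a ≡ b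

Full : ∀ {V : Set} → (V → Bool) → (V → Bool) → Set
Full U K = ∀ a → U a ≡ true → K a ≡ true

Missing : ∀ {V : Set} → (V → Bool) → (V → Bool) → Set
Missing U K = Σ _ λ z → U z ≡ true × K z ≡ false

_∩_ : ∀ {V : Set} → (V → Bool) → (V → Bool) → V → Bool
(U ∩ K) x = U x ∧ K x

∩-intro : ∀ {V : Set} (U K : V → Bool) {x} → U x ≡ true → K x ≡ true → (U ∩ K) x ≡ true
∩-intro U K Ux Kx rewrite Ux | Kx = refl

∩-elim : ∀ {V : Set} (U K : V → Bool) {x} → (U ∩ K) x ≡ true → U x ≡ true × K x ≡ true
∩-elim U K {x} h with U x | K x
... | true | true = refl , refl
... | true | false = contradiction h λ ()
... | false | _ = contradiction h λ ()

module _ {V : Set} (E : V → V → Bool) where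

  Mod : (V → Bool) → (V → Bool) → Set
  Mod U K = ∀ u a b → U u ≡ true → K u ≡ false → U a ≡ true → K a ≡ true →
            U b ≡ true → K b ≡ true → E u a ≡ E u b

  -- E restricted to U has only trivial modules (the size condition is kept separate).
  Prime : (V → Bool) → Set
  Prime U = ∀ K → Mod U K → Small U K ⊎ Full U K

  Twins : (V → Bool) → V → V → Set
  Twins U p q = ∀ u → U u ≡ true → u ≢ p → u ≢ q → E u p ≡ E u q

  TwinFree : (V → Bool) → Set
  TwinFree U = ∀ p q → U p ≡ true → U q ≡ true → p ≢ q → ¬ Twins U p q

Mod-restrict : ∀ {V : Set} (E E' : V → V → Bool) (U U' K : V → Bool) → Mod E U K →
  (∀ x → U' x ≡ true → U x ≡ true) →
  (∀ u a → U' u ≡ true → K u ≡ false → U' a ≡ true → K a ≡ true → E' u a ≡ E u a) →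
  Mod E' U' K
Mod-restrict E E' U U' K modK U'⊆U agree u a b U'u Ku U'a Ka U'b Kb = begin
  E' u a ≡⟨ agree u a U'u Ku U'a Ka ⟩
  E u a  ≡⟨ modK u a b (U'⊆U u U'u) Ku (U'⊆U a U'a) Ka (U'⊆U b U'b) Kb ⟩
  E u b  ≡⟨ agree u b U'u Ku U'b Kb ⟨
  E' u b ∎
  where open ≡-Reasoning

full-or-missing : ∀ {n} (W K : Fin n → Bool) → Full W K ⊎ Missing W K
full-or-missing {n} W K with all? (λ x → decT (W x) →-dec decT (K x))
... | yes full = inj₁ λ a Wa → full a Wa
... | no ¬full with ¬∀⟶∃¬ n _ (λ x → decT (W x) →-dec decT (K x)) ¬full
... | z , ¬z with W z in Wz | K z in Kz
...   | false | _ = contradiction (λ ()) ¬z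
...   | true | true = contradiction (λ _ → refl) ¬z
...   | true | false = inj₂ (z , Wz , Kz)

Extensional : ∀ {n} → ((Fin n → Bool) → Set) → Set
Extensional Q = ∀ f g → (∀ x → f x ≡ g x) → Q f → Q g

anySet? : ∀ {n} (Q : (Fin n → Bool) → Set) → Extensional Q → (∀ f → Dec (Q f)) → Dec (∃ Q)
anySet? Q ext Q? = map′ (λ (v , q) → lookup v , q)
  (λ (f , q) → tabulate f , ext f _ (λ x → sym (lookup∘tabulate f x)) q)
  (anySubset? (λ v → Q? (lookup v)))

largestSet : ∀ {n} (Q : (Fin n → Bool) → Set) → Extensional Q → (∀ f → Dec (Q f)) →
  ∃ Q → Σ (Fin n → Bool) λ K → Q K × (∀ K' → Q K' → count K' ≤ count K)
largestSet {n} Q ext Q? (K , qK) = climb n K qK (m≤n+m n (count K))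
  where
  -- each step strictly enlarges K; the fuel bounds the number of steps
  climb : ∀ fuel K → Q K → n ≤ count K + fuel →
    Σ (Fin n → Bool) λ K → Q K × (∀ K' → Q K' → count K' ≤ count K)
  climb zero K qK n≤ =
    K , qK , λ K' _ → ≤-trans (count-bound K') (≤-trans n≤ (≤-reflexive (+-identityʳ _)))
  climb (suc fuel) K qK n≤
    with anySet? (λ K' → Q K' × count K < count K')
           (λ f g f≗g (qf , lt) → ext f g f≗g qf , ≤-trans lt (≤-reflexive (count-cong f g f≗g)))
           (λ K' → Q? K' ×-dec (count K <? count K'))
  ... | yes (K' , qK' , lt) =
    climb fuel K' qK' (≤-trans n≤ (≤-trans (≤-reflexive (+-suc (count K) fuel)) (+-monoˡ-≤ fuel lt)))
  ... | no none = K , qK , λ K' qK' → ≮⇒≥ (λ lt → none (K' , qK' , lt))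

Two : ∀ {n} → (Fin n → Bool) → Set
Two W = Σ _ λ p → Σ _ λ q → W p ≡ true × W q ≡ true × p ≢ q

TwoWith : ∀ {n} → (Fin n → Bool) → (Fin n → Bool) → Bool → Set
TwoWith W X b = Σ _ λ p → Σ _ λ q → W p ≡ true × X p ≡ b × W q ≡ true × X q ≡ b × p ≢ q

withNew : ∀ {n} → (Fin n → Bool) → Maybe (Fin n) → Bool
withNew W nothing = true
withNew W (just a) = W a

-- One-vertex extensions of a graph A on Fin n: the new vertex is `nothing`,
-- adjacent exactly to the vertices in X.
module _ {n : ℕ} (A : Fin n → Fin n → Bool) where

  extend : (Fin n → Bool) → Maybe (Fin n) → Maybe (Fin n) → Bool
  extend X (just a) (just b) = A a b
  extend X nothing (just b) = X b
  extend X (just a) nothing = X a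
  extend X nothing nothing = false

  -- No vertex s of W is a twin of the new vertex in W + v: some u ∈ W ∖ {s}
  -- distinguishes s from the new vertex.
  Separated : (Fin n → Bool) → (Fin n → Bool) → Set
  Separated W X = ∀ s → W s ≡ true → Σ (Fin n) λ u → W u ≡ true × u ≢ s × A u s ≢ X u

  record Extension (W : Fin n → Bool) : Set where
    field
      X : Fin n → Bool
      twoIn : TwoWith W X true
      twoOut : TwoWith W X false
      prime : Prime (extend X) (withNew W)

  extension-prime : ∀ W X → Prime A W → TwoWith W X true → TwoWith W X false → Separated W X →
    Prime (extend X) (withNew W)
  extension-prime W X primeW (p , _ , Wp , Xp , _) (p' , _ , Wp' , Xp' , _) sep K modK
    with primeW (λ a → K (just a)) (λ u a b → modK (just u) (just a) (just b)) | K nothing in Kv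
  ... | inj₂ full | false = contradiction (begin
          true ≡⟨ Xp ⟨
          X p  ≡⟨ modK nothing (just p) (just p') refl Kv Wp (full p Wp) Wp' (full p' Wp') ⟩
          X p' ≡⟨ Xp' ⟩
          false ∎) true≢false
    where open ≡-Reasoning
  ... | inj₂ full | true = inj₂ λ { nothing _ → Kv ; (just a) Wa → full a Wa }
  ... | inj₁ small | false = inj₁ small'
    where
    small' : Small (withNew W) K
    small' nothing _ _ Ka _ _ = contradiction (trans (sym Ka) Kv) true≢false
    small' (just a) nothing _ _ _ Kb = contradiction (trans (sym Kb) Kv) true≢false
    small' (just a) (just b) Wa Ka Wb Kb = cong just (small a b Wa Ka Wb Kb)
  ... | inj₁ small | true with any? (λ s → decT (W s) ×-dec decT (K (just s)))
  ...   | no none = inj₁ onlyNew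
    where
    onlyNew : Small (withNew W) K
    onlyNew nothing nothing _ _ _ _ = refl
    onlyNew (just a) _ Wa Ka _ _ = contradiction (a , Wa , Ka) none
    onlyNew nothing (just b) _ _ Wb Kb = contradiction (b , Wb , Kb) none
  -- a vertex s of W in K would be a twin of the new vertex
  ...   | yes (s , Ws , Ks) with sep s Ws
  ...     | u , Wu , u≢s , Aus≢Xu with K (just u) in Ku
  ...       | true = contradiction (small u s Wu Ku Ws Ks) u≢s
  ...       | false = contradiction (modK (just u) (just s) nothing Wu Ku Ws Ks refl Kv) Aus≢Xu

separated-complement : ∀ {n} (A : Fin n → Fin n → Bool) W X →
  Separated (λ x y → not (A x y)) W X → Separated A W (λ x → not (X x))
separated-complement A W X sep s Ws with sep s Ws
... | u , Wu , u≢s , differ = u , Wu , u≢s ,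
      λ same → differ (trans (cong not same) (not-involutive (X u)))

pair : ∀ {n} → Fin n → Fin n → Fin n → Bool
pair a b x = x == a ∨ x == b

pair-a : ∀ {n} (a b : Fin n) → pair a b a ≡ true
pair-a a b rewrite ==-refl a = refl

pair-b : ∀ {n} (a b : Fin n) → pair a b b ≡ true
pair-b a b rewrite ==-refl b = ∨-zeroʳ (b == a)

pair-outside : ∀ {n} {a b x : Fin n} → x ≢ a → x ≢ b → pair a b x ≡ false
pair-outside x≢a x≢b rewrite ==-≢ x≢a | ==-≢ x≢b = refl

pair-cases : ∀ {n} (a b x : Fin n) → pair a b x ≡ true → x ≡ a ⊎ x ≡ b
pair-cases a b x h with x ≟ᶠ a | x ≟ᶠ b
... | yes x≡a | _ = inj₁ x≡a
... | no _ | yes x≡b = inj₂ x≡b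
... | no _ | no _ = contradiction h λ ()

-- Let a ∈ W have two non-neighbours in W ∖ {a}
-- (in the adjacency B). Then for some b ∈ W ∖ {a} the new vertex with neighbourhood
-- {a, b} has no twin in W + v. Otherwise each b would have a twin s_b, and b ↦ s_b
-- would inject W ∖ {a} into the smaller set W ∩ ({a} ∪ N(a)).
module _ {n : ℕ} (B : Fin n → Fin n → Bool) (W : Fin n → Bool) (a : Fin n) where

  -- s ∈ W is a twin of the new vertex with neighbourhood {a, b}.
  TwinOfNew : Fin n → Fin n → Set
  TwinOfNew b s = W s ≡ true × (∀ u → W u ≡ true → u ≢ s → B u s ≡ pair a b u)

  twinOfNew? : ∀ b → Dec (∃ (TwinOfNew b))
  twinOfNew? b = any? λ s → decT (W s) ×-dec all? λ u →
    decT (W u) →-dec (¬? (u ≟ᶠ s) →-dec (B u s ≟ᴮ pair a b u))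

  no-twin⇒separated : ∀ b → ¬ ∃ (TwinOfNew b) → Separated B W (pair a b)
  no-twin⇒separated b none s Ws
    with ¬∀⟶∃¬ n _ (λ u → decT (W u) →-dec (¬? (u ≟ᶠ s) →-dec (B u s ≟ᴮ pair a b u)))
                   (λ sees → none (s , Ws , sees))
  ... | u , ¬sees with W u in Wu | u ≟ᶠ s
  ...   | false | _ = contradiction (λ ()) ¬sees
  ...   | true | yes u≡s = contradiction (λ _ u≢s → contradiction u≡s u≢s) ¬sees
  ...   | true | no u≢s = u , Wu , u≢s , λ sees → ¬sees (λ _ _ → sees)

  -- A twin of the new vertex is a or a neighbour of a (a itself is adjacent to v).
  twin-near-a : ∀ {b s} → W a ≡ true → TwinOfNew b s → s ≡ a ⊎ B a s ≡ true
  twin-near-a {b} {s} Wa (_ , sees) with a ≟ᶠ s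
  ... | yes a≡s = inj₁ (sym a≡s)
  ... | no a≢s = inj₂ (trans (sees a Wa a≢s) (pair-a a b))

  -- The twin s determines b, as long as b ∉ {a, s}: b sees s as it sees the new vertex.
  twin-determines : ∀ {b c s} → W b ≡ true → b ≢ a → b ≢ s → TwinOfNew b s → TwinOfNew c s → b ≡ c
  twin-determines {b} {c} {s} Wb b≢a b≢s (_ , sees) (_ , sees') with b ≟ᶠ c
  ... | yes b≡c = b≡c
  ... | no b≢c = contradiction (begin
          true       ≡⟨ pair-b a b ⟨
          pair a b b ≡⟨ sees b Wb b≢s ⟨
          B b s      ≡⟨ sees' b Wb b≢s ⟩
          pair a c b ≡⟨ pair-outside b≢a b≢c ⟩
          false      ∎) true≢false
    where open ≡-Reasoning

  -- W ∖ {a}, and the part W ∩ ({a} ∪ N(a)) of W which contains every twin of the new vertex.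
  W∖a nearA : Fin n → Bool
  W∖a b = W b ∧ not (b == a)
  nearA s = W s ∧ (s == a ∨ B a s)

  ∈W∖a : ∀ {b} → W∖a b ≡ true → W b ≡ true × b ≢ a
  ∈W∖a {b} h with W b | b ≟ᶠ a
  ... | true | no b≢a = refl , b≢a
  ... | true | yes _ = contradiction h λ ()
  ... | false | _ = contradiction h λ ()

  twinOf : Fin n → Fin n
  twinOf b with twinOfNew? b
  ... | yes (s , _) = s
  ... | no _ = a

  twinOf-spec : ∀ {b} → ∃ (TwinOfNew b) → TwinOfNew b (twinOf b)
  twinOf-spec {b} t with twinOfNew? b
  ... | yes (_ , twin) = twin
  ... | no ¬t = contradiction t ¬t

  all-twins⇒injection : W a ≡ true → (∀ {b} → W∖a b ≡ true → ∃ (TwinOfNew b)) →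
    count W∖a ≤ count nearA
  all-twins⇒injection Wa hasTwin = count-injection W∖a nearA twinOf maps-into injective
    where
    maps-into : ∀ b → W∖a b ≡ true → nearA (twinOf b) ≡ true
    maps-into b h = inNearA (proj₁ twin) (twin-near-a Wa twin)
      where
      twin = twinOf-spec (hasTwin h)
      inNearA : ∀ {s} → W s ≡ true → s ≡ a ⊎ B a s ≡ true → nearA s ≡ true
      inNearA Ws (inj₁ refl) rewrite Ws | ==-refl a = refl
      inNearA {s} Ws (inj₂ Bas) rewrite Ws | Bas = ∨-zeroʳ (s == a)

    injective : ∀ x y → W∖a x ≡ true → W∖a y ≡ true → twinOf x ≡ twinOf y → x ≡ y
    injective x y hx hy e with x ≟ᶠ twinOf x | y ≟ᶠ twinOf y
    ... | no x≢s | _ = twin-determines (proj₁ (∈W∖a hx)) (proj₂ (∈W∖a hx)) x≢s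
                         (twinOf-spec (hasTwin hx))
                         (subst (TwinOfNew y) (sym e) (twinOf-spec (hasTwin hy)))
    ... | yes _ | no y≢s = sym (twin-determines (proj₁ (∈W∖a hy)) (proj₂ (∈W∖a hy)) y≢s
                         (twinOf-spec (hasTwin hy)) (subst (TwinOfNew x) e (twinOf-spec (hasTwin hx))))
    ... | yes x≡s | yes y≡s = trans x≡s (trans e (sym y≡s))

  -- Two non-neighbours b₁, b₂ of a lie in W outside nearA, so nearA is smaller than W ∖ {a}.
  nearA<W∖a : ∀ {b₁ b₂} → W a ≡ true → W b₁ ≡ true → W b₂ ≡ true → b₁ ≢ a → b₂ ≢ a → b₁ ≢ b₂ →
    B a b₁ ≡ false → B a b₂ ≡ false → count nearA < count W∖a
  nearA<W∖a {b₁} {b₂} Wa Wb₁ Wb₂ b₁≢a b₂≢a b₁≢b₂ Bab₁ Bab₂ = +-cancelˡ-≤ 1 _ _ (begin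
    suc (suc (count nearA))                    ≡⟨ +-comm 2 (count nearA) ⟩
    count nearA + 2                            ≤⟨ +-monoʳ-≤ (count nearA) farFromA ⟩
    count nearA + count (λ x → W x ∧ not (x == a ∨ B a x)) ≡⟨ count-split W (λ x → x == a ∨ B a x) ⟨
    count W                                    ≡⟨ count-remove W a Wa ⟩
    suc (count W∖a)                            ∎)
    where
    open ≤-Reasoning
    outside : ∀ {b} → W b ≡ true → b ≢ a → B a b ≡ false → W b ∧ not (b == a ∨ B a b) ≡ true
    outside Wb b≢a Bab rewrite Wb | ==-≢ b≢a | Bab = refl
    farFromA : 2 ≤ count (λ x → W x ∧ not (x == a ∨ B a x))
    farFromA = count-two _ b₁ b₂ (outside Wb₁ b₁≢a Bab₁) (outside Wb₂ b₂≢a Bab₂) b₁≢b₂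

  separating-pair : (b₁ b₂ : Fin n) → W a ≡ true → W b₁ ≡ true → W b₂ ≡ true →
    b₁ ≢ a → b₂ ≢ a → b₁ ≢ b₂ → B a b₁ ≡ false → B a b₂ ≡ false →
    Σ (Fin n) λ b → W b ≡ true × b ≢ a × Separated B W (pair a b)
  separating-pair b₁ b₂ Wa Wb₁ Wb₂ b₁≢a b₂≢a b₁≢b₂ Bab₁ Bab₂
    with any? (λ b → decT (W b) ×-dec (¬? (b ≟ᶠ a) ×-dec ¬? (twinOfNew? b)))
  ... | yes (b , Wb , b≢a , none) = b , Wb , b≢a , no-twin⇒separated b none
  ... | no none = contradiction (all-twins⇒injection Wa hasTwin)
                    (<⇒≱ (nearA<W∖a Wa Wb₁ Wb₂ b₁≢a b₂≢a b₁≢b₂ Bab₁ Bab₂))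
    where
    hasTwin : ∀ {b} → W∖a b ≡ true → ∃ (TwinOfNew b)
    hasTwin {b} h with twinOfNew? b
    ... | yes t = t
    ... | no ¬t = contradiction (b , proj₁ (∈W∖a h) , proj₂ (∈W∖a h) , ¬t) none

Four : ∀ {n} → (Fin n → Bool) → Set
Four W = Σ _ λ p₁ → Σ _ λ p₂ → Σ _ λ p₃ → Σ _ λ p₄ →
  (W p₁ ≡ true × W p₂ ≡ true × W p₃ ≡ true × W p₄ ≡ true) ×
  (p₁ ≢ p₂ × p₁ ≢ p₃ × p₁ ≢ p₄ × p₂ ≢ p₃ × p₂ ≢ p₄ × p₃ ≢ p₄)

pair-at-most-two : ∀ {n} {a b x y z : Fin n} →
  pair a b x ≡ true → pair a b y ≡ true → pair a b z ≡ true → x ≢ y → x ≢ z → y ≢ z → ⊥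
pair-at-most-two {a = a} {b} {x} {y} {z} hx hy hz x≢y x≢z y≢z
  with pair-cases a b x hx | pair-cases a b y hy | pair-cases a b z hz
... | inj₁ refl | inj₁ refl | _ = x≢y refl
... | inj₂ refl | inj₂ refl | _ = x≢y refl
... | inj₁ refl | _ | inj₁ refl = x≢z refl
... | inj₂ refl | _ | inj₂ refl = x≢z refl
... | _ | inj₁ refl | inj₁ refl = y≢z refl
... | _ | inj₂ refl | inj₂ refl = y≢z refl

twoOutsidePair : ∀ {n} {W : Fin n → Bool} → Four W → ∀ a b → TwoWith W (pair a b) false
twoOutsidePair (p₁ , p₂ , p₃ , p₄ , (w₁ , w₂ , w₃ , w₄) , (d₁₂ , d₁₃ , d₁₄ , d₂₃ , d₂₄ , d₃₄)) a b
  with pair a b p₁ in e₁ | pair a b p₂ in e₂ | pair a b p₃ in e₃ | pair a b p₄ in e₄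
... | false | false | _ | _ = p₁ , p₂ , w₁ , e₁ , w₂ , e₂ , d₁₂
... | false | true | false | _ = p₁ , p₃ , w₁ , e₁ , w₃ , e₃ , d₁₃
... | false | true | true | false = p₁ , p₄ , w₁ , e₁ , w₄ , e₄ , d₁₄
... | false | true | true | true = ⊥-elim (pair-at-most-two e₂ e₃ e₄ d₂₃ d₂₄ d₃₄)
... | true | false | false | _ = p₂ , p₃ , w₂ , e₂ , w₃ , e₃ , d₂₃
... | true | false | true | false = p₂ , p₄ , w₂ , e₂ , w₄ , e₄ , d₂₄
... | true | false | true | true = ⊥-elim (pair-at-most-two e₁ e₃ e₄ d₁₃ d₁₄ d₃₄)
... | true | true | false | false = p₃ , p₄ , w₃ , e₃ , w₄ , e₄ , d₃₄
... | true | true | false | true = ⊥-elim (pair-at-most-two e₁ e₂ e₄ d₁₂ d₁₄ d₂₄)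
... | true | true | true | _ = ⊥-elim (pair-at-most-two e₁ e₂ e₃ d₁₂ d₁₃ d₂₃)

module _ {n : ℕ} (A : Fin n → Fin n → Bool) (A-sym : ∀ x y → A x y ≡ A y x) where

  undistinguished : (p q r : Fin n) → A r p ≡ A r q ⊎ (A q p ≡ A q r ⊎ A p q ≡ A p r)
  undistinguished p q r with bool-pigeonhole (A p q) (A p r) (A q r)
  ... | inj₁ same = inj₁ (trans (A-sym r p) (trans same (A-sym q r)))
  ... | inj₂ (inj₁ same) = inj₂ (inj₁ (trans (A-sym q p) same))
  ... | inj₂ (inj₂ same) = inj₂ (inj₂ same)

  distinguish : ∀ W p q → ¬ Twins A W p q →
    Σ (Fin n) λ t → W t ≡ true × t ≢ p × t ≢ q × A t p ≢ A t q
  distinguish W p q ¬twins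
    with ¬∀⟶∃¬ n _ (λ u → decT (W u) →-dec (¬? (u ≟ᶠ p) →-dec (¬? (u ≟ᶠ q) →-dec (A u p ≟ᴮ A u q))))
                   ¬twins
  ... | t , ¬t with W t in Wt | t ≟ᶠ p | t ≟ᶠ q | A t p ≟ᴮ A t q
  ... | false | _ | _ | _ = contradiction (λ ()) ¬t
  ... | true | yes t≡p | _ | _ = contradiction (λ _ t≢p → contradiction t≡p t≢p) ¬t
  ... | true | no _ | yes t≡q | _ = contradiction (λ _ _ t≢q → contradiction t≡q t≢q) ¬t
  ... | true | no _ | no _ | yes same = contradiction (λ _ _ _ → same) ¬t
  ... | true | no t≢p | no t≢q | no differ = t , Wt , t≢p , t≢q , differ

  -- A twin-free set with two vertices has four: r distinguishes p, q; one of p, q does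
  -- not distinguish the other from r, and the vertex distinguishing that pair is new.
  four : ∀ W → TwinFree A W → Two W → Four W
  four W twinFree (p , q , Wp , Wq , p≢q) with distinguish W p q (twinFree p q Wp Wq p≢q)
  ... | r , Wr , r≢p , r≢q , rpq with undistinguished p q r
  ... | inj₁ same = contradiction same rpq
  ... | inj₂ (inj₁ same) with distinguish W p r (twinFree p r Wp Wr (≢-sym r≢p))
  ...   | t , Wt , t≢p , t≢r , tpr = p , q , r , t , (Wp , Wq , Wr , Wt) ,
            (p≢q , ≢-sym r≢p , ≢-sym t≢p , ≢-sym r≢q , (λ { refl → tpr same }) , ≢-sym t≢r)
  four W twinFree (p , q , Wp , Wq , p≢q) | r , Wr , r≢p , r≢q , rpq | inj₂ (inj₂ same)
    with distinguish W q r (twinFree q r Wq Wr (≢-sym r≢q))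
  ...   | t , Wt , t≢q , t≢r , tqr = p , q , r , t , (Wp , Wq , Wr , Wt) ,
            (p≢q , ≢-sym r≢p , (λ { refl → tqr same }) , ≢-sym r≢q , ≢-sym t≢q , ≢-sym t≢r)

  TwoNonNeighbours : (Fin n → Bool) → Set
  TwoNonNeighbours W = Σ (Fin n) λ a → Σ (Fin n) λ b₁ → Σ (Fin n) λ b₂ →
    W a ≡ true × W b₁ ≡ true × W b₂ ≡ true × b₁ ≢ a × b₂ ≢ a × b₁ ≢ b₂ ×
    A a b₁ ≡ false × A a b₂ ≡ false

  twoNonNeighbours? : ∀ W → Dec (TwoNonNeighbours W)
  twoNonNeighbours? W = any? λ a → any? λ b₁ → any? λ b₂ →
    decT (W a) ×-dec decT (W b₁) ×-dec decT (W b₂) ×-dec ¬? (b₁ ≟ᶠ a) ×-dec ¬? (b₂ ≟ᶠ a) ×-dec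
    ¬? (b₁ ≟ᶠ b₂) ×-dec decF (A a b₁) ×-dec decF (A a b₂)

  pair-extension : ∀ W → Prime A W → Four W → TwoNonNeighbours W → Extension A W
  pair-extension W primeW F (a , b₁ , b₂ , Wa , Wb₁ , Wb₂ , b₁≢a , b₂≢a , b₁≢b₂ , Aab₁ , Aab₂)
    with separating-pair A W a b₁ b₂ Wa Wb₁ Wb₂ b₁≢a b₂≢a b₁≢b₂ Aab₁ Aab₂
  ... | b , Wb , b≢a , sep = record
    { X = pair a b ; twoIn = twoIn ; twoOut = twoOutsidePair F a b
    ; prime = extension-prime A W (pair a b) primeW twoIn (twoOutsidePair F a b) sep }
    where
    twoIn : TwoWith W (pair a b) true
    twoIn = a , b , Wa , pair-a a b , Wb , pair-b a b , ≢-sym b≢a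

  TwoNeighbours : (Fin n → Bool) → Set
  TwoNeighbours W = Σ (Fin n) λ a → Σ (Fin n) λ c₁ → Σ (Fin n) λ c₂ →
    W a ≡ true × W c₁ ≡ true × W c₂ ≡ true × c₁ ≢ a × c₂ ≢ a × c₁ ≢ c₂ ×
    A a c₁ ≡ true × A a c₂ ≡ true

  two-neighbours : ∀ {W} → Four W → ¬ TwoNonNeighbours W → TwoNeighbours W
  two-neighbours {W} (p₁ , p₂ , p₃ , p₄ , (w₁ , w₂ , w₃ , w₄) , (d₁₂ , d₁₃ , d₁₄ , d₂₃ , d₂₄ , d₃₄))
    ¬two = neighbours (A p₁ p₂) (A p₁ p₃) (A p₁ p₄) refl refl refl
    where
    neighbours : ∀ x y z → A p₁ p₂ ≡ x → A p₁ p₃ ≡ y → A p₁ p₄ ≡ z → TwoNeighbours W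
    neighbours true true _ e₂ e₃ _ =
      p₁ , p₂ , p₃ , w₁ , w₂ , w₃ , ≢-sym d₁₂ , ≢-sym d₁₃ , d₂₃ , e₂ , e₃
    neighbours true false true e₂ _ e₄ =
      p₁ , p₂ , p₄ , w₁ , w₂ , w₄ , ≢-sym d₁₂ , ≢-sym d₁₄ , d₂₄ , e₂ , e₄
    neighbours false true true _ e₃ e₄ =
      p₁ , p₃ , p₄ , w₁ , w₃ , w₄ , ≢-sym d₁₃ , ≢-sym d₁₄ , d₃₄ , e₃ , e₄
    neighbours true false false _ e₃ e₄ =
      contradiction (p₁ , p₃ , p₄ , w₁ , w₃ , w₄ , ≢-sym d₁₃ , ≢-sym d₁₄ , d₃₄ , e₃ , e₄) ¬two
    neighbours false true false e₂ _ e₄ =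
      contradiction (p₁ , p₂ , p₄ , w₁ , w₂ , w₄ , ≢-sym d₁₂ , ≢-sym d₁₄ , d₂₄ , e₂ , e₄) ¬two
    neighbours false false _ e₂ e₃ _ =
      contradiction (p₁ , p₂ , p₃ , w₁ , w₂ , w₃ , ≢-sym d₁₂ , ≢-sym d₁₃ , d₂₃ , e₂ , e₃) ¬two

  -- If a has two neighbours, these are non-neighbours in the complement graph, and the
  -- new vertex is attached to everything but a suitable pair {a, b}.
  copair-extension : ∀ W → Prime A W → Four W → TwoNeighbours W → Extension A W
  copair-extension W primeW F (a , c₁ , c₂ , Wa , Wc₁ , Wc₂ , c₁≢a , c₂≢a , c₁≢c₂ , Ac₁ , Ac₂)
    with separating-pair (λ x y → not (A x y)) W a c₁ c₂ Wa Wc₁ Wc₂ c₁≢a c₂≢a c₁≢c₂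
           (cong not Ac₁) (cong not Ac₂)
  ... | b , Wb , b≢a , sep = record
    { X = X ; twoIn = twoIn ; twoOut = twoOut
    ; prime = extension-prime A W X primeW twoIn twoOut (separated-complement A W (pair a b) sep) }
    where
    X : Fin n → Bool
    X x = not (pair a b x)
    twoIn : TwoWith W X true
    twoIn with twoOutsidePair F a b
    ... | p , q , Wp , out-p , Wq , out-q , p≢q =
      p , q , Wp , cong not out-p , Wq , cong not out-q , p≢q
    twoOut : TwoWith W X false
    twoOut = a , b , Wa , cong not (pair-a a b) , Wb , cong not (pair-b a b) , ≢-sym b≢a

  prime-base : ∀ W → Prime A W → TwinFree A W → Two W → Extension A W
  prime-base W primeW twinFree two = byNonNeighbours (twoNonNeighbours? W)
    where
    F : Four W
    F = four W twinFree two
    byNonNeighbours : Dec (TwoNonNeighbours W) → Extension A W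
    byNonNeighbours (yes nn) = pair-extension W primeW F nn
    byNonNeighbours (no ¬nn) = copair-extension W primeW F (two-neighbours F ¬nn)

  ProperModule : (Fin n → Bool) → (Fin n → Bool) → Set
  ProperModule W K = (∀ x → K x ≡ true → W x ≡ true) × Mod A W K × Two K × Missing W K

  properModule? : ∀ W K → Dec (ProperModule W K)
  properModule? W K =
    all? (λ x → decT (K x) →-dec decT (W x)) ×-dec
    all? (λ u → all? λ a → all? λ b → decT (W u) →-dec decF (K u) →-dec decT (W a) →-dec
           decT (K a) →-dec decT (W b) →-dec decT (K b) →-dec (A u a ≟ᴮ A u b)) ×-dec
    any? (λ p → any? λ q → decT (K p) ×-dec decT (K q) ×-dec ¬? (p ≟ᶠ q)) ×-dec
    any? (λ z → decT (W z) ×-dec decF (K z))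

  properModule-ext : ∀ W → Extensional (ProperModule W)
  properModule-ext W f g f≗g (f⊆W , modf , (p , q , fp , fq , p≢q) , (z , Wz , fz)) =
    (λ x gx → f⊆W x (trans (f≗g x) gx)) ,
    (λ u a b Wu gu Wa ga Wb gb →
       modf u a b Wu (trans (f≗g u) gu) Wa (trans (f≗g a) ga) Wb (trans (f≗g b) gb)) ,
    (p , q , trans (sym (f≗g p)) fp , trans (sym (f≗g q)) fq , p≢q) ,
    (z , Wz , trans (sym (f≗g z)) fz)

  trace-proper : ∀ W K → Mod A W K → ∀ {p q} → W p ≡ true → K p ≡ true → W q ≡ true → K q ≡ true →
    p ≢ q → Missing W K → ProperModule W (W ∩ K)
  trace-proper W K modK Wp Kp Wq Kq p≢q (z , Wz , Kz) =
    (λ x h → proj₁ (∩-elim W K h)) ,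
    (λ u a b Wu WKu Wa WKa Wb WKb →
       modK u a b Wu (outside Wu WKu) Wa (proj₂ (∩-elim W K WKa)) Wb (proj₂ (∩-elim W K WKb))) ,
    (_ , _ , ∩-intro W K Wp Kp , ∩-intro W K Wq Kq , p≢q) ,
    (z , Wz , trans (cong (_∧ K z) Wz) Kz)
    where
    outside : ∀ {u} → W u ≡ true → (W ∩ K) u ≡ false → K u ≡ false
    outside Wu WKu rewrite Wu = WKu

  -- A module of W that is neither full nor small would have a proper trace on W.
  noProper⇒prime : ∀ W → ¬ ∃ (ProperModule W) → Prime A W
  noProper⇒prime W none K modK with full-or-missing W K
  ... | inj₁ full = inj₂ full
  ... | inj₂ missing = inj₁ small
    where
    small : Small W K
    small a b Wa Ka Wb Kb with a ≟ᶠ b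
    ... | yes a≡b = a≡b
    ... | no a≢b = contradiction (_ , trace-proper W K modK Wa Ka Wb Kb a≢b missing) none

  record MaximalModule (W : Fin n → Bool) : Set where
    field
      M : Fin n → Bool
      M⊆W : ∀ x → M x ≡ true → W x ≡ true
      modM : Mod A W M
      -- two vertices of M; m also represents M in the quotient of W
      m m' : Fin n
      Mm : M m ≡ true
      Mm' : M m' ≡ true
      m≢m' : m ≢ m'
      missingM : Missing W M
      largest : ∀ K → ProperModule W K → count K ≤ count M

    twoM : Two M
    twoM = m , m' , Mm , Mm' , m≢m'

  maximalModule : ∀ W → ∃ (ProperModule W) → MaximalModule W
  maximalModule W proper with largestSet (ProperModule W) (properModule-ext W) (properModule? W) proper
  ... | M , (M⊆W , modM , (m , m' , Mm , Mm' , m≢m') , missingM) , largestM = record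
    { M = M ; M⊆W = M⊆W ; modM = modM ; m = m ; m' = m' ; Mm = Mm ; Mm' = Mm' ; m≢m' = m≢m'
    ; missingM = missingM ; largest = largestM }

  module _ {W : Fin n → Bool} (mm : MaximalModule W) where
    open MaximalModule mm

    maximal-full : ∀ K → Mod A W K → (∀ x → M x ≡ true → K x ≡ true) →
      ∀ {z} → W z ≡ true → K z ≡ true → M z ≡ false → Full W K
    maximal-full K modK M⊆K {z} Wz Kz Mz with full-or-missing W K
    ... | inj₁ full = full
    ... | inj₂ missing =
      contradiction (largest (W ∩ K) traceProper) (<⇒≱ M<trace)
      where
      traceProper : ProperModule W (W ∩ K)
      traceProper = trace-proper W K modK (M⊆W m Mm) (M⊆K m Mm) (M⊆W m' Mm') (M⊆K m' Mm') m≢m' missing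
      M<trace : count M < count (W ∩ K)
      M<trace = count-strict M (W ∩ K) (λ x Mx → ∩-intro W K (M⊆W x Mx) (M⊆K x Mx))
                  z (∩-intro W K Wz Kz) Mz

    M-smaller : count M < count W
    M-smaller with missingM
    ... | z , Wz , Mz = count-strict M W M⊆W z Wz Mz

  -- A module of a twin-free set is twin-free: twins in K ⊆ W are twins in W, as the
  -- vertices outside K see p and q alike.
  module-twinFree : ∀ W K → (∀ x → K x ≡ true → W x ≡ true) → Mod A W K →
    TwinFree A W → TwinFree A K
  module-twinFree W K K⊆W modK twinFree p q Kp Kq p≢q twinsK =
    twinFree p q (K⊆W p Kp) (K⊆W q Kq) p≢q twinsW
    where
    twinsW : Twins A W p q
    twinsW w Ww w≢p w≢q with K w in Kw
    ... | true = twinsK w Kw w≢p w≢q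
    ... | false = modK w p q Ww Kw (K⊆W p Kp) Kp (K⊆W q Kq) Kq

  HasTwins : (Fin n → Bool) → Set
  HasTwins W = Σ (Fin n) λ p → Σ (Fin n) λ q → W p ≡ true × W q ≡ true × p ≢ q × Twins A W p q

  hasTwins? : ∀ W → Dec (HasTwins W)
  hasTwins? W = any? λ p → any? λ q → decT (W p) ×-dec decT (W q) ×-dec ¬? (p ≟ᶠ q) ×-dec
    all? λ u → decT (W u) →-dec ¬? (u ≟ᶠ p) →-dec ¬? (u ≟ᶠ q) →-dec (A u p ≟ᴮ A u q)

  -- The new vertex gets
  -- neighbourhood Y on M; off M it is chosen via the quotient W' = (W ∖ M) ∪ {m}.
  module InductiveStep {W : Fin n → Bool} (twinFree : TwinFree A W) (mm : MaximalModule W)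
    (recM : Extension A (MaximalModule.M mm)) where
    open MaximalModule mm
    open Extension recM renaming (X to Y; twoIn to twoInY; twoOut to twoOutY; prime to primeY)

    outside-M : ∀ {w a b} → W w ≡ true → M w ≡ false → M a ≡ true → M b ≡ true → A w a ≡ A w b
    outside-M Ww Mw Ma Mb = modM _ _ _ Ww Mw (M⊆W _ Ma) Ma (M⊆W _ Mb) Mb

    M≢ : ∀ {x y} → M x ≡ false → M y ≡ true → x ≢ y
    M≢ Mx My refl = true≢false (trans (sym My) Mx)

    Agrees : (Fin n → Bool) → Set
    Agrees X = ∀ x → M x ≡ true → X x ≡ Y x

    lift-two : ∀ {X b} → Agrees X → TwoWith M Y b → TwoWith W X b
    lift-two agrees (p , q , Mp , Yp , Mq , Yq , p≢q) =
      p , q , M⊆W p Mp , trans (agrees p Mp) Yp , M⊆W q Mq , trans (agrees q Mq) Yq , p≢q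

    restrict-to-M : ∀ {X} → Agrees X → ∀ K → Mod (extend A X) (withNew W) K →
      Mod (extend A Y) (withNew M) K
    restrict-to-M {X} agrees K modK =
      Mod-restrict (extend A X) (extend A Y) (withNew W) (withNew M) K modK sub agree
      where
      sub : ∀ x → withNew M x ≡ true → withNew W x ≡ true
      sub nothing _ = refl
      sub (just a) Ma = M⊆W a Ma
      agree : ∀ u a → withNew M u ≡ true → K u ≡ false → withNew M a ≡ true → K a ≡ true →
        extend A Y u a ≡ extend A X u a
      agree (just u) (just a) _ _ _ _ = refl
      agree nothing (just a) _ _ Ma _ = sym (agrees a Ma)
      agree (just u) nothing Mu _ _ _ = sym (agrees u Mu)
      agree nothing nothing _ _ _ _ = refl

    -- A module meeting M + v only in v meets W + v only in v: a vertex r ∈ K ∖ M would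
    -- force v to see all of M alike, as r does, whereas Y is not constant on M.
    new-alone : ∀ {X} → Agrees X → ∀ K → Mod (extend A X) (withNew W) K → Small (withNew M) K →
      K nothing ≡ true → Small (withNew W) K
    new-alone {X} agrees K modK small Kv a b Wa Ka Wb Kb = trans (isNew a Wa Ka) (sym (isNew b Wb Kb))
      where
      avoidsM : ∀ {x} → M x ≡ true → K (just x) ≡ false
      avoidsM {x} Mx with K (just x) in Kx
      ... | false = refl
      ... | true = contradiction (small nothing (just x) refl Kv Mx Kx) λ ()

      sees-like : ∀ {r x} → W r ≡ true → K (just r) ≡ true → M x ≡ true → Y x ≡ A r x
      sees-like {r} {x} Wr Kr Mx = begin
        Y x   ≡⟨ agrees x Mx ⟨
        X x   ≡⟨ modK (just x) nothing (just r) (M⊆W x Mx) (avoidsM Mx) refl Kv Wr Kr ⟩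
        A x r ≡⟨ A-sym x r ⟩
        A r x ∎
        where open ≡-Reasoning

      isNew : ∀ a → withNew W a ≡ true → K a ≡ true → a ≡ nothing
      isNew nothing _ _ = refl
      isNew (just r) Wr Kr with M r in Mr | twoInY | twoOutY
      ... | true | _ | _ = contradiction (trans (sym Kr) (avoidsM Mr)) true≢false
      ... | false | (p , _ , Mp , Yp , _) | (q , _ , Mq , Yq , _) = contradiction (begin
            true  ≡⟨ Yp ⟨
            Y p   ≡⟨ sees-like Wr Kr Mp ⟩
            A r p ≡⟨ outside-M Wr Mr Mp Mq ⟩
            A r q ≡⟨ sees-like Wr Kr Mq ⟨
            Y q   ≡⟨ Yq ⟩
            false ∎) true≢false
        where open ≡-Reasoning

    extension-from-cases : ∀ X → Agrees X →
      (∀ K → Mod (extend A X) (withNew W) K → Full (withNew M) K → Full (withNew W) K) →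
      (∀ K → Mod (extend A X) (withNew W) K → Small (withNew M) K → K nothing ≡ false →
         Small (withNew W) K) →
      Extension A W
    extension-from-cases X agrees fullCase smallCase = record
      { X = X ; twoIn = lift-two agrees twoInY ; twoOut = lift-two agrees twoOutY ; prime = prime }
      where
      prime : Prime (extend A X) (withNew W)
      prime K modK with primeY K (restrict-to-M agrees K modK) | K nothing in Kv
      ... | inj₂ full | _ = inj₂ (fullCase K modK full)
      ... | inj₁ small | true = inj₁ (new-alone agrees K modK small Kv)
      ... | inj₁ small | false = inj₁ (smallCase K modK small Kv)

    -- The quotient: W ∖ M together with the representative m.
    W' : Fin n → Bool
    W' x = (W x ∧ not (M x)) ∨ (x == m)

    W'-cases : ∀ {x} → W' x ≡ true → (W x ≡ true × M x ≡ false) ⊎ x ≡ m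
    W'-cases {x} h with W x | M x | x ≟ᶠ m
    ... | _ | _ | yes x≡m = inj₂ x≡m
    ... | true | false | no _ = inj₁ (refl , refl)
    ... | true | true | no _ = contradiction h λ ()
    ... | false | _ | no _ = contradiction h λ ()

    W'-outside : ∀ {x} → W x ≡ true → M x ≡ false → W' x ≡ true
    W'-outside Wx Mx rewrite Wx | Mx = refl

    W'-m : W' m ≡ true
    W'-m rewrite ==-refl m = ∨-zeroʳ _

    W'⊆W : ∀ x → W' x ≡ true → W x ≡ true
    W'⊆W x h with W'-cases h
    ... | inj₁ (Wx , _) = Wx
    ... | inj₂ refl = M⊆W m Mm

    W'-smaller : count W' < count W
    W'-smaller = count-strict W' W W'⊆W m' (M⊆W m' Mm') W'm'
      where
      W'm' : W' m' ≡ false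
      W'm' rewrite Mm' | ==-≢ (≢-sym m≢m') | ∧-zeroʳ (W m') = refl

    W'-two : Two W'
    W'-two with missingM
    ... | z , Wz , Mz = m , z , W'-m , W'-outside Wz Mz , ≢-sym (M≢ Mz Mm)

    -- Twins of W' outside M would be twins of W; so twins of W' are m and some u ∉ M.
    quotient-twins : HasTwins W' → Σ (Fin n) λ u → W u ≡ true × M u ≡ false × Twins A W' m u
    quotient-twins (p , q , W'p , W'q , p≢q , twins) with W'-cases W'p | W'-cases W'q
    ... | inj₂ refl | inj₂ refl = contradiction refl p≢q
    ... | inj₂ refl | inj₁ (Wq , Mq) = q , Wq , Mq , twins
    ... | inj₁ (Wp , Mp) | inj₂ refl = p , Wp , Mp , λ w W'w w≢q w≢p → sym (twins w W'w w≢p w≢q)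
    ... | inj₁ (Wp , Mp) | inj₁ (Wq , Mq) = contradiction twinsW (twinFree p q Wp Wq p≢q)
      where
      twinsW : Twins A W p q
      twinsW w Ww w≢p w≢q with M w in Mw
      ... | false = twins w (W'-outside Ww Mw) w≢p w≢q
      ... | true = begin
        A w p ≡⟨ A-sym w p ⟩
        A p w ≡⟨ outside-M Wp Mp Mw Mm ⟩
        A p m ≡⟨ A-sym p m ⟩
        A m p ≡⟨ twins m W'-m (≢-sym (M≢ Mp Mm)) (≢-sym (M≢ Mq Mm)) ⟩
        A m q ≡⟨ A-sym m q ⟩
        A q m ≡⟨ outside-M Wq Mq Mm Mw ⟩
        A q w ≡⟨ A-sym q w ⟩
        A w q ∎
        where open ≡-Reasoning

    -- If m and u ∉ M are twins in W', then M ∪ {u} is a module of W, hence all of W.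
    twin-fills : ∀ {u} → W u ≡ true → M u ≡ false → Twins A W' m u →
      ∀ z → W z ≡ true → M z ≡ false → z ≡ u
    twin-fills {u} Wu Mu twins z Wz Mz with maximal-full mm K modK M⊆K Wu Ku Mu z Wz
      where
      K : Fin n → Bool
      K x = M x ∨ (x == u)
      M⊆K : ∀ x → M x ≡ true → K x ≡ true
      M⊆K x Mx rewrite Mx = refl
      Ku : K u ≡ true
      Ku rewrite Mu = ==-refl u
      like-m : ∀ w a → W w ≡ true → K w ≡ false → K a ≡ true → A w a ≡ A w m
      like-m w a Ww Kw Ka with M w in Mw | w ≟ᶠ u | M a in Ma
      ... | true | _ | _ = contradiction Kw λ ()
      ... | false | yes _ | _ = contradiction Kw λ ()
      ... | false | no _ | true = outside-M Ww Mw Ma Mm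
      ... | false | no w≢u | false with ==⇒≡ {x = a} {y = u} Ka
      ...   | refl = sym (twins w (W'-outside Ww Mw) (M≢ Mw Mm) w≢u)
      modK : Mod A W K
      modK w a b Ww Kw _ Ka _ Kb = trans (like-m w a Ww Kw Ka) (sym (like-m w b Ww Kw Kb))
    ... | Kz rewrite Mz = ==⇒≡ {x = z} {y = u} Kz

    module OneOutside {u : Fin n} (Wu : W u ≡ true) (Mu : M u ≡ false)
      (onlyU : ∀ z → W z ≡ true → M z ≡ false → z ≡ u) where

      X : Fin n → Bool
      X x = if M x then Y x else not (A u m)

      agrees : Agrees X
      agrees x Mx rewrite Mx = refl

      Xu : X u ≡ not (A u m)
      Xu rewrite Mu = refl

      in-M-or-u : ∀ {z} → W z ≡ true → M z ≡ true ⊎ z ≡ u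
      in-M-or-u {z} Wz with M z in Mz
      ... | true = inj₁ refl
      ... | false = inj₂ (onlyU z Wz Mz)

      -- K ⊇ M + v must contain u, since u sees m and v differently.
      fullCase : ∀ K → Mod (extend A X) (withNew W) K → Full (withNew M) K → Full (withNew W) K
      fullCase K modK full with K (just u) in Ku
      ... | false = contradiction (trans sameView Xu) (not-¬ refl)
        where
        sameView : A u m ≡ X u
        sameView =
          modK (just u) (just m) nothing Wu Ku (M⊆W m Mm) (full (just m) Mm) refl (full nothing refl)
      ... | true = λ { nothing _ → full nothing refl ; (just z) Wz → inK z Wz }
        where
        inK : ∀ z → W z ≡ true → K (just z) ≡ true
        inK z Wz with in-M-or-u Wz
        ... | inj₁ Mz = full (just z) Mz
        ... | inj₂ refl = Ku

      -- K ∌ v meeting M in at most one vertex: if it also contains u and some x ∈ M,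
      -- then x and u would be twins of W.
      smallCase : ∀ K → Mod (extend A X) (withNew W) K → Small (withNew M) K → K nothing ≡ false →
        Small (withNew W) K
      smallCase K modK small Kv with K (just u) in Ku
      ... | false = λ a b Wa Ka Wb Kb → inM a Wa Ka b Wb Kb
        where
        inM : ∀ a → withNew W a ≡ true → K a ≡ true → ∀ b → withNew W b ≡ true → K b ≡ true → a ≡ b
        inM nothing _ Ka _ _ _ = contradiction (trans (sym Ka) Kv) true≢false
        inM (just _) _ _ nothing _ Kb = contradiction (trans (sym Kb) Kv) true≢false
        inM (just x) Wx Kx (just y) Wy Ky with in-M-or-u Wx | in-M-or-u Wy
        ... | inj₂ refl | _ = contradiction (trans (sym Kx) Ku) true≢false
        ... | _ | inj₂ refl = contradiction (trans (sym Ky) Ku) true≢false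
        ... | inj₁ Mx | inj₁ My = small (just x) (just y) Mx Kx My Ky
      ... | true with any? (λ x → decT (M x) ×-dec decT (K (just x)))
      ...   | yes (x , Mx , Kx) = contradiction twins (twinFree x u (M⊆W x Mx) Wu (≢-sym (M≢ Mu Mx)))
        where
        twins : Twins A W x u
        twins w Ww w≢x w≢u with in-M-or-u Ww
        ... | inj₂ w≡u = contradiction w≡u w≢u
        ... | inj₁ Mw with K (just w) in Kw
        ...   | true = contradiction (just-injective (small (just w) (just x) Mw Kw Mx Kx)) w≢x
        ...   | false = modK (just w) (just x) (just u) Ww Kw (M⊆W x Mx) Kx Wu Ku
      ...   | no none = λ a b Wa Ka Wb Kb → trans (isU a Wa Ka) (sym (isU b Wb Kb))
        where
        isU : ∀ a → withNew W a ≡ true → K a ≡ true → a ≡ just u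
        isU nothing _ Ka = contradiction (trans (sym Ka) Kv) true≢false
        isU (just z) Wz Kz with in-M-or-u Wz
        ... | inj₁ Mz = contradiction (z , Mz , Kz) none
        ... | inj₂ refl = refl

      extension : Extension A W
      extension = extension-from-cases X agrees fullCase smallCase

    -- If a module K ∌ v meets M and W ∖ M, then M ∪ K is a module of W, hence all of W
    -- by maximality; so v sees every vertex of W ∖ M as it sees a vertex x ∈ K ∩ M.
    spread : ∀ X K → Mod (extend A X) (withNew W) K → K nothing ≡ false →
      ∀ {x z} → M x ≡ true → K (just x) ≡ true → W z ≡ true → M z ≡ false → K (just z) ≡ true →
      ∀ {r} → W r ≡ true → M r ≡ false → X r ≡ X x
    spread X K modK Kv {x} Mx Kx Wz Mz Kz {r} Wr Mr with fullL r Wr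
      where
      L : Fin n → Bool
      L y = M y ∨ K (just y)
      M⊆L : ∀ y → M y ≡ true → L y ≡ true
      M⊆L y My rewrite My = refl
      like-x : ∀ w a → W w ≡ true → L w ≡ false → W a ≡ true → L a ≡ true → A w a ≡ A w x
      like-x w a Ww Lw Wa La with M w in Mw | K (just w) in Kw | M a in Ma
      ... | true | _ | _ = contradiction Lw λ ()
      ... | false | true | _ = contradiction Lw λ ()
      ... | false | false | true = outside-M Ww Mw Ma Mx
      ... | false | false | false = modK (just w) (just a) (just x) Ww Kw Wa La (M⊆W x Mx) Kx
      fullL : Full W L
      fullL = maximal-full mm L
        (λ w a b Ww Lw Wa La Wb Lb → trans (like-x w a Ww Lw Wa La) (sym (like-x w b Ww Lw Wb Lb)))
                M⊆L Wz (trans (cong (_∨ K (just _)) Mz) Kz) Mz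
    ... | Lr rewrite Mr = modK nothing (just r) (just x) refl Kv Wr Lr (M⊆W x Mx) Kx

    module Quotient (recW' : Extension A W') where
      open Extension recW' renaming (X to X'; twoIn to twoIn'; twoOut to twoOut'; prime to prime')

      X : Fin n → Bool
      X x = if M x then Y x else X' x

      agrees : Agrees X
      agrees x Mx rewrite Mx = refl

      agrees-off : ∀ {x} → M x ≡ false → X x ≡ X' x
      agrees-off Mx rewrite Mx = refl

      outside-with : ∀ {b} → TwoWith W' X' b → Σ (Fin n) λ r → W r ≡ true × M r ≡ false × X' r ≡ b
      outside-with (p , q , W'p , X'p , W'q , X'q , p≢q) with W'-cases W'p | W'-cases W'q
      ... | inj₁ (Wp , Mp) | _ = p , Wp , Mp , X'p
      ... | inj₂ _ | inj₁ (Wq , Mq) = q , Wq , Mq , X'q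
      ... | inj₂ refl | inj₂ refl = contradiction refl p≢q

      restrict-to-W' : ∀ K → Mod (extend A X) (withNew W) K → K nothing ≡ K (just m) →
        Mod (extend A X') (withNew W') K
      restrict-to-W' K modK v~m =
        Mod-restrict (extend A X) (extend A X') (withNew W) (withNew W') K modK sub agree
        where
        sub : ∀ x → withNew W' x ≡ true → withNew W x ≡ true
        sub nothing _ = refl
        sub (just a) W'a = W'⊆W a W'a
        agree : ∀ u a → withNew W' u ≡ true → K u ≡ false → withNew W' a ≡ true → K a ≡ true →
          extend A X' u a ≡ extend A X u a
        agree (just u) (just a) _ _ _ _ = refl
        agree nothing nothing _ _ _ _ = refl
        agree nothing (just a) _ Kv W'a Ka with W'-cases W'a
        ... | inj₁ (_ , Ma) = sym (agrees-off Ma)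
        ... | inj₂ refl = contradiction (trans (sym Ka) (trans (sym v~m) Kv)) true≢false
        agree (just u) nothing W'u Ku _ Kv with W'-cases W'u
        ... | inj₁ (_ , Mu) = sym (agrees-off Mu)
        ... | inj₂ refl = contradiction (trans (sym Kv) (trans v~m Ku)) true≢false

      -- K ⊇ M + v is a module of W' + v containing v and m, hence contains all of W' + v.
      fullCase : ∀ K → Mod (extend A X) (withNew W) K → Full (withNew M) K → Full (withNew W) K
      fullCase K modK full
        with prime' K (restrict-to-W' K modK (trans (full nothing refl) (sym (full (just m) Mm))))
      ... | inj₁ small' =
        contradiction (small' nothing (just m) refl (full nothing refl) W'-m (full (just m) Mm)) λ ()
      ... | inj₂ full' = λ { nothing _ → full nothing refl ; (just z) Wz → inK z Wz }
        where
        inK : ∀ z → W z ≡ true → K (just z) ≡ true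
        inK z Wz with M z in Mz
        ... | true = full (just z) Mz
        ... | false = full' (just z) (W'-outside Wz Mz)

      -- A module avoiding v and M is a module of W' + v, which cannot be full, so it is small.
      avoiding-small : ∀ K → Mod (extend A X) (withNew W) K → K nothing ≡ false →
        (∀ {x} → M x ≡ true → K (just x) ≡ false) → Small (withNew W) K
      avoiding-small K modK Kv avoidsM
        with prime' K (restrict-to-W' K modK (trans Kv (sym (avoidsM Mm))))
      ... | inj₂ full' = contradiction (trans (sym (full' nothing refl)) Kv) true≢false
      ... | inj₁ small' = λ a b Wa Ka Wb Kb → small' a b (inW' a Wa Ka) Ka (inW' b Wb Kb) Kb
        where
        inW' : ∀ a → withNew W a ≡ true → K a ≡ true → withNew W' a ≡ true
        inW' nothing _ Ka = contradiction (trans (sym Ka) Kv) true≢false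
        inW' (just x) Wx Kx =
          W'-outside Wx (≢true⇒false (λ Mx → true≢false (trans (sym Kx) (avoidsM Mx))))

      -- X' takes both values on W' ∖ {m}, so v does not see all of W ∖ M alike.
      not-constant : ∀ {c} → (∀ {r} → W r ≡ true → M r ≡ false → X r ≡ c) → ⊥
      not-constant {c} constant with outside-with twoIn' | outside-with twoOut'
      ... | r₁ , Wr₁ , Mr₁ , X'r₁ | r₂ , Wr₂ , Mr₂ , X'r₂ = true≢false (begin
        true  ≡⟨ X'r₁ ⟨
        X' r₁ ≡⟨ agrees-off Mr₁ ⟨
        X r₁  ≡⟨ constant Wr₁ Mr₁ ⟩
        c     ≡⟨ constant Wr₂ Mr₂ ⟨
        X r₂  ≡⟨ agrees-off Mr₂ ⟩
        X' r₂ ≡⟨ X'r₂ ⟩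
        false ∎)
        where open ≡-Reasoning

      -- K ∌ v: if K avoids M it is small as above; if it lies in M it meets M at most
      -- once; and it cannot meet both M and W ∖ M, by spread and not-constant.
      smallCase : ∀ K → Mod (extend A X) (withNew W) K → Small (withNew M) K → K nothing ≡ false →
        Small (withNew W) K
      smallCase K modK small Kv with any? (λ x → decT (M x) ×-dec decT (K (just x)))
      ... | no meetsM = avoiding-small K modK Kv (λ Mx → ≢true⇒false (λ Kx → meetsM (_ , Mx , Kx)))
      ... | yes (x , Mx , Kx) with any? (λ r → decT (W r) ×-dec decF (M r) ×-dec decT (K (just r)))
      ...   | yes (z , Wz , Mz , Kz) = ⊥-elim (not-constant (spread X K modK Kv Mx Kx Wz Mz Kz))
      ...   | no insideM = λ a b Wa Ka Wb Kb → small a b (inM a Wa Ka) Ka (inM b Wb Kb) Kb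
        where
        inM : ∀ a → withNew W a ≡ true → K a ≡ true → withNew M a ≡ true
        inM nothing _ Ka = contradiction (trans (sym Ka) Kv) true≢false
        inM (just y) Wy Ky = ≢false⇒true (λ My → insideM (y , Wy , My , Ky))

      extension : Extension A W
      extension = extension-from-cases X agrees fullCase smallCase

  twinFree-extension : ∀ k W → count W ≤ k → TwinFree A W → Two W → Extension A W
  twinFree-extension zero W ≤0 _ (p , q , Wp , Wq , p≢q) =
    contradiction (≤-trans (count-two W p q Wp Wq p≢q) ≤0) λ ()
  twinFree-extension (suc k) W ≤k twinFree two
    with anySet? (ProperModule W) (properModule-ext W) (properModule? W)
  ... | no none = prime-base W (noProper⇒prime W none) twinFree two
  ... | yes proper = step (maximalModule W proper)
    where
    shrink : ∀ {c} → c < count W → c ≤ k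
    shrink lt = ≤-pred (≤-trans lt ≤k)

    step : MaximalModule W → Extension A W
    step mm = byTwins (hasTwins? W')
      where
      open MaximalModule mm
      recM : Extension A M
      recM = twinFree-extension k M (shrink (M-smaller mm)) (module-twinFree W M M⊆W modM twinFree) twoM
      open InductiveStep twinFree mm recM
      byTwins : Dec (HasTwins W') → Extension A W
      byTwins (yes twins) with quotient-twins twins
      ... | u , Wu , Mu , twinsU = OneOutside.extension Wu Mu (twin-fills Wu Mu twinsU)
      byTwins (no ¬twins) =
        Quotient.extension (twinFree-extension k W' (shrink W'-smaller) twinFree' W'-two)
        where
        twinFree' : TwinFree A W'
        twinFree' p q W'p W'q p≢q twins = ¬twins (p , q , W'p , W'q , p≢q , twins)

-- Interface with the notions of Defs. A graph G on Fin n is read as its adjacency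
-- adj G with vertex set `everything`; subsets (Boolean vectors) are read as predicates.

everything : ∀ {V : Set} → V → Bool
everything _ = true

card≡count : ∀ {k} (S : Subset k) → Subset.∣ S ∣ ≡ count (lookup S)
card≡count [] = refl
card≡count (true ∷ S) = cong suc (card≡count S)
card≡count (false ∷ S) = card≡count S

∈tabulate : ∀ {k} {K : Fin k → Bool} {x} → x Subset.∈ tabulate K → K x ≡ true
∈tabulate {K = K} {x} x∈K = trans (sym (lookup∘tabulate K x)) ([]=⇒lookup x∈K)

∉tabulate : ∀ {k} {K : Fin k → Bool} {x} → x Subset.∉ tabulate K → K x ≡ false
∉tabulate {K = K} {x} x∉K = ≢true⇒false λ Kx → x∉K (lookup⇒[]= x _ (trans (lookup∘tabulate K x) Kx))

module _ {k : ℕ} (Γ : Graph k) where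

  module⇒Mod : ∀ S → IsModule Γ S → Mod (adj Γ) everything (lookup S)
  module⇒Mod S modS u a b _ Su _ Sa _ Sb
    with modS u (λ u∈S → true≢false (trans (sym ([]=⇒lookup u∈S)) Su))
  ... | inj₁ allT = trans (allT a (lookup⇒[]= a S Sa)) (sym (allT b (lookup⇒[]= b S Sb)))
  ... | inj₂ allF = trans (allF a (lookup⇒[]= a S Sa)) (sym (allF b (lookup⇒[]= b S Sb)))

  Mod⇒module : ∀ K → Mod (adj Γ) everything K → IsModule Γ (tabulate K)
  Mod⇒module K modK v v∉K with any? (λ x → decT (K x))
  ... | no empty = inj₁ λ x x∈K → contradiction (x , ∈tabulate x∈K) empty
  ... | yes (x₀ , Kx₀) = uniform (adj Γ v x₀) refl
    where
    likeX₀ : ∀ {x} → x Subset.∈ tabulate K → adj Γ v x ≡ adj Γ v x₀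
    likeX₀ x∈K = modK v _ x₀ refl (∉tabulate v∉K) refl (∈tabulate x∈K) refl Kx₀
    uniform : ∀ c → adj Γ v x₀ ≡ c → (∀ x → x Subset.∈ tabulate K → adj Γ v x ≡ true) ⊎
                                     (∀ x → x Subset.∈ tabulate K → adj Γ v x ≡ false)
    uniform true e = inj₁ λ x x∈K → trans (likeX₀ x∈K) e
    uniform false e = inj₂ λ x x∈K → trans (likeX₀ x∈K) e

constant-vector : ∀ {k} (S : Subset k) b → (∀ i → lookup S i ≡ b) → S ≡ replicate k b
constant-vector [] b h = refl
constant-vector (x ∷ S) b h = cong₂ _∷_ (h zero) (constant-vector S b (λ i → h (suc i)))

trivial⇒small-or-full : ∀ {k} (S : Subset k) → IsTrivial S →
  Small everything (lookup S) ⊎ Full everything (lookup S)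
trivial⇒small-or-full S (inj₁ refl) =
  inj₁ λ a _ _ Sa _ _ → contradiction (trans (sym Sa) (lookup-replicate a false)) true≢false
trivial⇒small-or-full S (inj₂ (inj₁ refl)) = inj₂ λ a _ → lookup-replicate a true
trivial⇒small-or-full S (inj₂ (inj₂ ∣S∣≡1)) = inj₁ single
  where
  single : Small everything (lookup S)
  single a b _ Sa _ Sb with a ≟ᶠ b
  ... | yes a≡b = a≡b
  ... | no a≢b =
    contradiction (trans (sym ∣S∣≡1) (card≡count S)) (<⇒≢ (count-two (lookup S) a b Sa Sb a≢b))

small-or-full⇒trivial : ∀ {k} (S : Subset k) →
  Small everything (lookup S) ⊎ Full everything (lookup S) → IsTrivial S
small-or-full⇒trivial S (inj₂ full) = inj₂ (inj₁ (constant-vector S true (λ i → full i refl)))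
small-or-full⇒trivial S (inj₁ small) with any? (λ x → decT (lookup S x))
... | no empty = inj₁ (constant-vector S false (λ i → ≢true⇒false (λ Si → empty (i , Si))))
... | yes (x , Sx) = inj₂ (inj₂ (begin
  Subset.∣ S ∣                                ≡⟨ card≡count S ⟩
  count (lookup S)                            ≡⟨ count-remove (lookup S) x Sx ⟩
  suc (count (λ i → lookup S i ∧ not (i == x))) ≡⟨ cong suc (count-empty _ onlyX) ⟩
  1                                           ∎))
  where
  open ≡-Reasoning
  onlyX : ∀ i → lookup S i ∧ not (i == x) ≡ false
  onlyX i with lookup S i in Si
  ... | false = refl
  ... | true rewrite small i x refl Si refl Sx | ==-refl x = refl

module _ {k : ℕ} (Γ : Graph k) where

  isPrime⇒Prime : IsPrime Γ → Prime (adj Γ) everything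
  isPrime⇒Prime (_ , trivial) K modK
    with trivial⇒small-or-full (tabulate K) (trivial (tabulate K) (Mod⇒module Γ K modK))
  ... | inj₁ small = inj₁ λ a b _ Ka _ Kb →
          small a b refl (trans (lookup∘tabulate K a) Ka) refl (trans (lookup∘tabulate K b) Kb)
  ... | inj₂ full = inj₂ λ a _ → trans (sym (lookup∘tabulate K a)) (full a refl)

  Prime⇒isPrime : 4 ≤ k → Prime (adj Γ) everything → IsPrime Γ
  Prime⇒isPrime 4≤k prime =
    4≤k , λ S modS → small-or-full⇒trivial S (prime (lookup S) (module⇒Mod Γ S modS))

prime-transfer : ∀ {V V' : Set} (E : V → V → Bool) (E' : V' → V' → Bool) (U : V → Bool) →
  (∀ x → U x ≡ true) → (f : V' → V) (g : V → V') → (∀ x → f (g x) ≡ x) → (∀ y → g (f y) ≡ y) →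
  (∀ y z → E' y z ≡ E (f y) (f z)) → Prime E U → Prime E' everything
prime-transfer E E' U Uall f g fg gf hom prime K' modK' with prime (λ x → K' (g x)) modK
  where
  modK : Mod E U (λ x → K' (g x))
  modK u a b _ Ku _ Ka _ Kb = begin
    E u a                 ≡⟨ cong₂ E (fg u) (fg a) ⟨
    E (f (g u)) (f (g a)) ≡⟨ hom (g u) (g a) ⟨
    E' (g u) (g a)        ≡⟨ modK' (g u) (g a) (g b) refl Ku refl Ka refl Kb ⟩
    E' (g u) (g b)        ≡⟨ hom (g u) (g b) ⟩
    E (f (g u)) (f (g b)) ≡⟨ cong₂ E (fg u) (fg b) ⟩
    E u b                 ∎
    where open ≡-Reasoning
... | inj₁ small = inj₁ λ y z _ Ky _ Kz →
  trans (sym (gf y)) (trans (cong g (small (f y) (f z) (Uall _) (trans (cong K' (gf y)) Ky) (Uall _)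
                                         (trans (cong K' (gf z)) Kz))) (gf z))
... | inj₂ full = inj₂ λ y _ → trans (sym (cong K' (gf y))) (full (f y) (Uall _))

module _ {n : ℕ} (G : Graph n) where

  pair-false : ∀ {a b x : Fin n} → pair a b x ≡ false → x ≢ a × x ≢ b
  pair-false {a} {b} h = (λ { refl → true≢false (trans (sym (pair-a a b)) h) })
                       , (λ { refl → true≢false (trans (sym (pair-b a b)) h) })

  pairSet : Fin n → Fin n → Subset n
  pairSet p q = tabulate (pair p q)

  twins-Mod : ∀ {p q} → Twins (adj G) everything p q → Mod (adj G) everything (pair p q)
  twins-Mod {p} {q} twins u a b _ u∉ _ a∈ _ b∈ = trans (likeP a∈) (sym (likeP b∈))
    where
    likeP : ∀ {x} → pair p q x ≡ true → adj G u x ≡ adj G u p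
    likeP {x} x∈ with pair-cases p q x x∈
    ... | inj₁ refl = refl
    ... | inj₂ refl = sym (twins u refl (proj₁ (pair-false u∉)) (proj₂ (pair-false u∉)))

  twins-module : ∀ {p q} → Twins (adj G) everything p q → IsModule G (pairSet p q)
  twins-module {p} {q} twins = Mod⇒module G (pair p q) (twins-Mod twins)

  pair-size : ∀ {p q} → p ≢ q → 1 < Subset.∣ pairSet p q ∣
  pair-size {p} {q} p≢q = begin
    2                                       ≤⟨ count-two (pair p q) p q (pair-a p q) (pair-b p q) p≢q ⟩
    count (pair p q)                        ≡⟨ count-cong _ _ (lookup∘tabulate (pair p q)) ⟨
    count (lookup (pairSet p q))            ≡⟨ card≡count (pairSet p q) ⟨
    Subset.∣ pairSet p q ∣                  ∎
    where open ≤-Reasoning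

  pair-edge : ∀ {p q x y} → x Subset.∈ pairSet p q → y Subset.∈ pairSet p q → x ≢ y →
    adj G x y ≡ adj G p q
  pair-edge {p} {q} {x} {y} x∈ y∈ x≢y
    with pair-cases p q x (∈tabulate x∈) | pair-cases p q y (∈tabulate y∈)
  ... | inj₁ refl | inj₁ refl = contradiction refl x≢y
  ... | inj₂ refl | inj₂ refl = contradiction refl x≢y
  ... | inj₁ refl | inj₂ refl = refl
  ... | inj₂ refl | inj₁ refl = Graph.sym G x y

  twinFree : ModularStabilityNumber G 1 → ModularCliqueNumber G 1 → TwinFree (adj G) everything
  twinFree (_ , α≤1) (_ , ω≤1) p q _ _ p≢q twins with adj G p q in e
  ... | true = contradiction (ω≤1 (pairSet p q) (twins-module twins) clique) (<⇒≱ (pair-size p≢q))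
    where
    clique : IsClique G (pairSet p q)
    clique x y x∈ y∈ x≢y = trans (pair-edge x∈ y∈ x≢y) e
  ... | false = contradiction (α≤1 (pairSet p q) (twins-module twins) stable) (<⇒≱ (pair-size p≢q))
    where
    stable : IsStable G (pairSet p q)
    stable x y x∈ y∈ with x ≟ᶠ y
    ... | yes refl = Graph.irrefl G x
    ... | no x≢y = trans (pair-edge x∈ y∈ x≢y) e

  -- One-vertex extensions as graphs on Fin (n + 1): the new vertex is the last one.
  toMaybe : Fin (n + 1) → Maybe (Fin n)
  toMaybe i = [ just , (λ _ → nothing) ]′ (splitAt n i)

  fromMaybe : Maybe (Fin n) → Fin (n + 1)
  fromMaybe (just a) = a ↑ˡ 1
  fromMaybe nothing = n ↑ʳ zero

  to∘from : ∀ x → toMaybe (fromMaybe x) ≡ x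
  to∘from (just a) rewrite splitAt-↑ˡ n a 1 = refl
  to∘from nothing rewrite splitAt-↑ʳ n 1 zero = refl

  from∘to : ∀ i → fromMaybe (toMaybe i) ≡ i
  from∘to i with splitAt n i | join-splitAt n 1 i
  ... | inj₁ a | i≡ = i≡
  ... | inj₂ zero | i≡ = i≡

  extend-sym : ∀ X x y → extend (adj G) X x y ≡ extend (adj G) X y x
  extend-sym X (just a) (just b) = Graph.sym G a b
  extend-sym X nothing (just b) = refl
  extend-sym X (just a) nothing = refl
  extend-sym X nothing nothing = refl

  extend-irrefl : ∀ X x → extend (adj G) X x x ≡ false
  extend-irrefl X (just a) = Graph.irrefl G a
  extend-irrefl X nothing = refl

  extensionGraph : (Fin n → Bool) → Graph (n + 1)
  extensionGraph X = record
    { adj = λ i j → extend (adj G) X (toMaybe i) (toMaybe j)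
    ; sym = λ i j → extend-sym X (toMaybe i) (toMaybe j)
    ; irrefl = λ i → extend-irrefl X (toMaybe i) }

  extensionGraph-extends : ∀ X → IsExtension 1 G (extensionGraph X)
  extensionGraph-extends X i j rewrite splitAt-↑ˡ n i 1 | splitAt-↑ˡ n j 1 = refl

  extensionGraph-prime : 4 ≤ n → ∀ X → Prime (extend (adj G) X) (withNew everything) →
    IsPrime (extensionGraph X)
  extensionGraph-prime 4≤n X prime = Prime⇒isPrime (extensionGraph X) (≤-trans 4≤n (m≤m+n n 1))
    (prime-transfer (extend (adj G) X) (adj (extensionGraph X)) (withNew everything) allNew
      toMaybe fromMaybe to∘from from∘to (λ _ _ → refl) prime)
    where
    allNew : ∀ x → withNew everything x ≡ true
    allNew nothing = refl
    allNew (just _) = refl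

  -- A 0-extension of G is a copy of G, so it is prime only if G is.
  no-prime-0-extension : ¬ IsPrime G → 4 ≤ n → ¬ HasPrimeExtension G 0
  no-prime-0-extension ¬prime 4≤n (H , extends , primeH) = ¬prime (Prime⇒isPrime G 4≤n
    (prime-transfer (adj H) (adj G) everything (λ _ → refl) (_↑ˡ 0) strip strip-↑ˡ ↑ˡ-strip
      (λ i j → sym (extends i j)) (isPrime⇒Prime H primeH)))
    where
    strip : Fin (n + 0) → Fin n
    strip i = [ (λ a → a) , (λ ()) ]′ (splitAt n i)
    strip-↑ˡ : ∀ i → strip i ↑ˡ 0 ≡ i
    strip-↑ˡ i with splitAt n i | join-splitAt n 0 i
    ... | inj₁ a | i≡ = i≡
    ↑ˡ-strip : ∀ a → strip (a ↑ˡ 0) ≡ a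
    ↑ˡ-strip a rewrite splitAt-↑ˡ n a 0 = refl

two-vertices : ∀ {n} → 2 ≤ n → Two {n} everything
two-vertices (s≤s (s≤s _)) = zero , suc zero , refl , refl , λ ()

proposition8 : ∀ {n : ℕ} (G : Graph n) → ¬ IsPrime G → 4 ≤ n →
    ModularStabilityNumber G 1 → ModularCliqueNumber G 1 → PrimeBound G 1
proposition8 {n} G ¬prime 4≤n αM ωM =
  (extensionGraph G X , extensionGraph-extends G X , extensionGraph-prime G 4≤n X prime) , noSmaller
  where
  extensionG : Extension (adj G) everything
  extensionG = twinFree-extension (adj G) (Graph.sym G) n everything (count-bound everything)
                 (twinFree G αM ωM) (two-vertices (≤-trans (s≤s (s≤s z≤n)) 4≤n))
  open Extension extensionG using (X; prime)
  noSmaller : ∀ q → q < 1 → ¬ HasPrimeExtension G q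
  noSmaller zero _ = no-prime-0-extension G ¬prime 4≤n
  noSmaller (suc q) (s≤s ())
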